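{- Let $C=(x_0,y_0,x_1,y_1)$ be a $4$-vertex alternating cycle of a graph $G$, and let $T$ be a tree whose leaf set contains $\{x_0,y_0,x_1,y_1\}$. Then $T$ can satisfy $C$ if and only if $T$ contains the quartet $x_0y_0|x_1y_1$.
   Context: A sequence $C=(x_0,y_0,x_1,y_1)$ of four distinct vertices of $G$ is an alternating cycle if $x_0y_0,x_1y_1\in E(G)$ and $y_0x_1,y_1x_0\notin E(G)$. For a weighting $f:E(T)\to\mathbb{N}^+$, $d_f(x,y)$ is the sum of $f$ over the edges of the $x$–$y$ path in $T$; $(T,f)$ satisfies $C$ if there is a threshold $k$ with $d_f(x_0,y_0)\le k$, $d_f(x_1,y_1)\le k$, $d_f(y_0,x_1)>k$, $d_f(y_1,x_0)>k$. An unweighted tree $T$ can satisfy $C$ if some weighting $f:E(T)\to\mathbb{N}^+$ makes $(T,f)$ satisfy $C$. A tree $T$ contains the quartet $ab|cd$ if $a,b,c,d$ are leaves of $T$ and the path between $a$ and $b$ in $T$ does not intersect the path between $c$ and $d$. -}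

module Defs where

open import Data.Nat using (ℕ; zero; suc; _+_; _≤_; _<_)
open import Data.Fin using (Fin)
open import Data.List using (List; []; _∷_; length)
open import Data.List.Relation.Unary.Unique.Propositional using (Unique)
open import Data.List.Membership.Propositional using (_∈_)
open import Data.Product using (Σ; ∃; _×_; _,_)
open import Relation.Binary.PropositionalEquality using (_≡_; _≢_)
open import Relation.Nullary using (¬_)

record Graph (n : ℕ) : Set₁ where
  field
    Adj     : Fin n → Fin n → Set
    sym     : ∀ {u v} → Adj u v → Adj v u
    irrefl  : ∀ {u} → ¬ Adj u u
open Graph public

module _ {n : ℕ} (T : Graph n) where

  data Walk : Fin n → Fin n → List (Fin n) → Set where
    here : ∀ {x} → Walk x x (x ∷ [])
    step : ∀ {x y z p} → Adj T x y → Walk y z p → Walk x z (x ∷ p)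

  IsPath : Fin n → Fin n → List (Fin n) → Set
  IsPath x y p = Walk x y p × Unique p

  Connected : Set
  Connected = ∀ x y → ∃ λ p → IsPath x y p

  HasCycle : Set
  HasCycle = Σ (Fin n) λ x → Σ (Fin n) λ y → Σ (List (Fin n)) λ p →
               IsPath x y p × 3 ≤ length p × Adj T y x

  IsTree : Set
  IsTree = Connected × ¬ HasCycle

  IsLeaf : Fin n → Set
  IsLeaf v = Σ (Fin n) λ u → Adj T v u × (∀ w → Adj T v w → w ≡ u)

  -- Edge weighting f : E(T) → ℕ⁺, given as a function on ordered pairs that is
  -- symmetric and positive on edges (values on non-edges are irrelevant).
  IsWeighting : (Fin n → Fin n → ℕ) → Set
  IsWeighting f = (∀ u v → Adj T u v → f u v ≡ f v u) × (∀ u v → Adj T u v → 0 < f u v)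

  weight : (Fin n → Fin n → ℕ) → List (Fin n) → ℕ
  weight f (x ∷ y ∷ r) = f x y + weight f (y ∷ r)
  weight f _ = 0

  -- d_f(x,y) ≤ k  and  d_f(x,y) > k  (d_f is the weight of the x–y path of T).
  DistLe : (Fin n → Fin n → ℕ) → Fin n → Fin n → ℕ → Set
  DistLe f x y k = ∀ p → IsPath x y p → weight f p ≤ k

  DistGt : (Fin n → Fin n → ℕ) → Fin n → Fin n → ℕ → Set
  DistGt f x y k = ∀ p → IsPath x y p → k < weight f p

  Satisfies : (Fin n → Fin n → ℕ) → Fin n → Fin n → Fin n → Fin n → Set
  Satisfies f x0 y0 x1 y1 = Σ ℕ λ k →
    DistLe f x0 y0 k × DistLe f x1 y1 k × DistGt f y0 x1 k × DistGt f y1 x0 k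

  CanSatisfy : Fin n → Fin n → Fin n → Fin n → Set
  CanSatisfy x0 y0 x1 y1 = Σ (Fin n → Fin n → ℕ) λ f → IsWeighting f × Satisfies f x0 y0 x1 y1

  ContainsQuartet : Fin n → Fin n → Fin n → Fin n → Set
  ContainsQuartet a b c d = IsLeaf a × IsLeaf b × IsLeaf c × IsLeaf d ×
    (∀ p q → IsPath a b p → IsPath c d q → ∀ v → v ∈ p → ¬ (v ∈ q))

AlternatingCycle : ∀ {m} → Graph m → Fin m → Fin m → Fin m → Fin m → Set
AlternatingCycle G x0 y0 x1 y1 =
  (x0 ≢ y0 × x0 ≢ x1 × x0 ≢ y1 × y0 ≢ x1 × y0 ≢ y1 × x1 ≢ y1) ×
  Adj G x0 y0 × Adj G x1 y1 × ¬ Adj G y0 x1 × ¬ Adj G y1 x0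

module Submission where

-- Proof idea.  Write w(p) for the f-weight of a vertex sequence p.
--
-- (⇒) holds in every graph, for every weighting symmetric on edges.  If the
-- x0–y0 path p and the x1–y1 path q shared a vertex v, split p = A·B and
-- q = C·D at v.  Reversing C·B and A·D gives walks y0 ⇝ x1 and y1 ⇝ x0, which
-- shortcut to paths of weight at most w(C)+w(B) and w(A)+w(D).  Satisfaction
-- then gives w(A)+w(B) ≤ k, w(C)+w(D) ≤ k, k < w(C)+w(B), k < w(A)+w(D),
-- and adding the inequalities yields 2k < 2k.
--
-- (⇐) uses only acyclicity.  Given disjoint paths P and Q, give cost 1 to
-- pairs lying together in P or in Q and cost K+1 to all other pairs, where
-- K = |P| + |Q|.  In an acyclic graph paths are unique, so every x0–y0 or
-- x1–y1 path is P or Q, of weight ≤ K; every y0–x1 path leaves P and every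
-- y1–x0 path leaves Q, paying K+1 on the exit edge.

open import Defs hiding (sym)
open import Data.Nat using (ℕ; suc; _+_; _≤_; _<_; z≤n; s≤s)
open import Data.Nat.Properties
  using (≤-refl; ≤-trans; ≤-reflexive; <-irrefl; +-mono-≤; +-mono-<; +-monoʳ-≤;
         +-assoc; +-comm; +-identityʳ; m≤m+n; m≤n+m)
open import Data.Nat.Solver using (module +-*-Solver)
open import Data.Fin using (Fin; _≟_)
open import Data.List using (List; []; _∷_; length)
open import Data.List.Relation.Unary.Any using (here; there)
open import Data.List.Relation.Unary.All using ([]; _∷_)
import Data.List.Relation.Unary.All as All
open import Data.List.Relation.Unary.All.Properties using (¬Any⇒All¬)
open import Data.List.Relation.Unary.AllPairs using ([]; _∷_)
open import Data.List.Relation.Unary.Unique.Propositional using (Unique)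
open import Data.List.Membership.Propositional using (_∈_; _∉_)
open import Data.List.Relation.Binary.Subset.Propositional using (_⊆_)
open import Data.Product using (∃; _×_; _,_; proj₁)
open import Data.Sum using (_⊎_; inj₁; inj₂)
import Data.Sum as Sum
open import Data.Empty using (⊥; ⊥-elim)
open import Relation.Nullary using (¬_; yes; no)
open import Relation.Nullary.Decidable using (_×-dec_; _⊎-dec_)
open import Function using (_⇔_; mk⇔)
open import Function.Definitions using (Injective)
open import Relation.Binary.PropositionalEquality
  using (_≡_; refl; sym; trans; cong; cong₂; subst; module ≡-Reasoning)

four-point-contradiction : ∀ a b c d k →
  a + b ≤ k → c + d ≤ k → k < c + b → k < a + d → ⊥
four-point-contradiction a b c d k ab≤k cd≤k k<cb k<ad =
  <-irrefl refl (begin-strict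
    k + k             <⟨ +-mono-< k<cb k<ad ⟩
    (c + b) + (a + d) ≡⟨ regroup ⟩
    (a + b) + (c + d) ≤⟨ +-mono-≤ ab≤k cd≤k ⟩
    k + k             ∎)
  where
  open Data.Nat.Properties.≤-Reasoning
  open +-*-Solver using (solve; _:+_; _:=_)
  regroup : (c + b) + (a + d) ≡ (a + b) + (c + d)
  regroup = solve 4 (λ a b c d → (c :+ b) :+ (a :+ d) := (a :+ b) :+ (c :+ d))
                    refl a b c d

module WalkSurgery {n : ℕ} (T : Graph n) where
  open import Data.List.Membership.DecPropositional (_≟_ {n}) using (_∈?_)

  Weighting : Set
  Weighting = Fin n → Fin n → ℕ

  SymmetricOnEdges : Weighting → Set
  SymmetricOnEdges f = ∀ u v → Adj T u v → f u v ≡ f v u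

  walk-start : ∀ {x y p} → Walk T x y p → x ∈ p
  walk-start here       = here refl
  walk-start (step _ _) = here refl

  walk-end : ∀ {x y p} → Walk T x y p → y ∈ p
  walk-end here       = here refl
  walk-end (step _ w) = there (walk-end w)

  weight-cons : ∀ f {x y z r} → Walk T y z r → weight T f (x ∷ r) ≡ f x y + weight T f r
  weight-cons f here       = refl
  weight-cons f (step _ _) = refl

  walk-length : ∀ {a b r} → Walk T a b r → ¬ a ≡ b → 2 ≤ length r
  walk-length here                ne = ⊥-elim (ne refl)
  walk-length (step _ here)       _  = s≤s (s≤s z≤n)
  walk-length (step _ (step _ _)) _  = s≤s (s≤s z≤n)

  split : ∀ {a b p v} → Walk T a b p → v ∈ p →
    ∃ λ p₁ → ∃ λ p₂ → Walk T a v p₁ × Walk T v b p₂ ×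
      (∀ f → weight T f p₁ + weight T f p₂ ≡ weight T f p)
  split here       (here refl) = _ , _ , here , here , λ _ → refl
  split (step e w) (here refl) = _ , _ , here , step e w , λ _ → refl
  split (step {x} {y} {p = p} e w) (there v∈p) with split w v∈p
  ... | p₁ , p₂ , w₁ , w₂ , sum = _ , p₂ , step e w₁ , w₂ , λ f → begin
      weight T f (x ∷ p₁) + weight T f p₂   ≡⟨ cong (_+ _) (weight-cons f w₁) ⟩
      (f x y + weight T f p₁) + weight T f p₂ ≡⟨ +-assoc (f x y) _ _ ⟩
      f x y + (weight T f p₁ + weight T f p₂) ≡⟨ cong (f x y +_) (sum f) ⟩
      f x y + weight T f p                   ≡⟨ sym (weight-cons f w) ⟩
      weight T f (x ∷ p)                     ∎
    where open ≡-Reasoning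

  join : ∀ {a b c p q} → Walk T a b p → Walk T b c q →
    ∃ λ r → Walk T a c r × (∀ f → weight T f r ≡ weight T f p + weight T f q) ×
      (∀ {v} → v ∈ r → v ∈ p ⊎ v ∈ q)
  join here w₂ = _ , w₂ , (λ _ → refl) , inj₂
  join {q = q} (step {x} {y} {p = p} e w₁) w₂ with join w₁ w₂
  ... | r , wr , sum , mem = x ∷ r , step e wr , (λ f → begin
      weight T f (x ∷ r)                       ≡⟨ weight-cons f wr ⟩
      f x y + weight T f r                     ≡⟨ cong (f x y +_) (sum f) ⟩
      f x y + (weight T f p + weight T f q)    ≡⟨ sym (+-assoc (f x y) _ _) ⟩
      (f x y + weight T f p) + weight T f q    ≡⟨ cong (_+ weight T f q) (sym (weight-cons f w₁)) ⟩
      weight T f (x ∷ p) + weight T f q        ∎) ,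
    λ { (here refl) → inj₁ (here refl) ; (there v∈r) → Sum.map₁ there (mem v∈r) }
    where open ≡-Reasoning

  reverse : ∀ {a b p} → Walk T a b p →
    ∃ λ q → Walk T b a q × q ⊆ p ×
      (∀ f → SymmetricOnEdges f → weight T f q ≡ weight T f p)
  reverse here = _ , here , (λ v∈ → v∈) , λ _ _ → refl
  reverse (step {x} {y} {p = p} e w) with reverse w
  ... | q , wq , q⊆p , wt with join wq (step (Graph.sym T e) here)
  ... | r , wr , sum , mem = r , wr , (λ v∈r → back (mem v∈r)) , λ f fsym → begin
      weight T f r                   ≡⟨ sum f ⟩
      weight T f q + (f y x + 0)     ≡⟨ cong₂ _+_ (wt f fsym) (+-identityʳ (f y x)) ⟩
      weight T f p + f y x           ≡⟨ cong (weight T f p +_) (sym (fsym x y e)) ⟩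
      weight T f p + f x y           ≡⟨ +-comm (weight T f p) (f x y) ⟩
      f x y + weight T f p           ≡⟨ sym (weight-cons f w) ⟩
      weight T f (x ∷ p)             ∎
    where
    open ≡-Reasoning
    back : ∀ {v} → v ∈ q ⊎ v ∈ (y ∷ x ∷ []) → v ∈ (x ∷ p)
    back (inj₁ v∈q)                   = there (q⊆p v∈q)
    back (inj₂ (here refl))           = there (walk-start w)
    back (inj₂ (there (here refl)))   = here refl
    back (inj₂ (there (there ())))

  suffix : ∀ {y z q v} → Walk T y z q → v ∈ q →
    ∃ λ q′ → Walk T v z q′ × (Unique q → Unique q′) × q′ ⊆ q ×
      (∀ f → weight T f q′ ≤ weight T f q)
  suffix here       (here refl) = _ , here , (λ u → u) , (λ m → m) , λ _ → ≤-refl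
  suffix (step e w) (here refl) = _ , step e w , (λ u → u) , (λ m → m) , λ _ → ≤-refl
  suffix (step {x} {y} e w) (there v∈q) with suffix w v∈q
  ... | q′ , w′ , uniq , q′⊆q , le = q′ , w′ , (λ { (_ ∷ u) → uniq u }) , (λ m → there (q′⊆q m)) ,
      λ f → ≤-trans (le f) (≤-trans (m≤n+m _ (f x y)) (≤-reflexive (sym (weight-cons f w))))

  shortcut : ∀ {x z p} → Walk T x z p →
    ∃ λ q → IsPath T x z q × q ⊆ p × (∀ f → weight T f q ≤ weight T f p)
  shortcut here = _ , (here , [] ∷ []) , (λ m → m) , λ _ → ≤-refl
  shortcut {x} (step {y = y} e w) with shortcut w
  ... | q , (wq , uq) , q⊆p , le with x ∈? q
  ...   | yes x∈q with suffix wq x∈q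
  ...     | q′ , wq′ , uniq , q′⊆q , le′ = q′ , (wq′ , uniq uq) , (λ m → there (q⊆p (q′⊆q m))) ,
            λ f → ≤-trans (le′ f) (≤-trans (le f)
                    (≤-trans (m≤n+m _ (f x y)) (≤-reflexive (sym (weight-cons f w)))))
  shortcut {x} (step {y = y} e w) | q , (wq , uq) , q⊆p , le | no x∉q =
    x ∷ q , (step e wq , ¬Any⇒All¬ q x∉q ∷ uq) ,
    (λ { (here refl) → here refl ; (there m) → there (q⊆p m) }) ,
    λ f → ≤-trans (≤-reflexive (weight-cons f wq))
            (≤-trans (+-monoʳ-≤ (f x y) (le f)) (≤-reflexive (sym (weight-cons f w))))

  path-back : ∀ f → SymmetricOnEdges f → ∀ {a v b p q} → Walk T a v p → Walk T v b q →
    ∃ λ r → IsPath T b a r × weight T f r ≤ weight T f p + weight T f q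
  path-back f fsym w₁ w₂ with join w₁ w₂
  ... | j , wj , sum , _ with reverse wj
  ... | r , wr , _ , wt with shortcut wr
  ... | s , ps , _ , le = s , ps ,
      ≤-trans (le f) (≤-reflexive (trans (wt f fsym) (sum f)))

  -- Two paths
  -- leaving x through different neighbours a ≠ b would close a cycle
  -- x → a ⇝ b → x, obtained by shortcutting a ⇝ x ⇝ b while avoiding x.
  path-unique : ¬ HasCycle T → ∀ {x y p q} → IsPath T x y p → IsPath T x y q → p ≡ q
  path-unique _ (here , _) (here , _) = refl
  path-unique _ (here , _) (step _ w , x∉ ∷ _) = ⊥-elim (All.lookup x∉ (walk-end w) refl)
  path-unique _ (step _ w , x∉ ∷ _) (here , _) = ⊥-elim (All.lookup x∉ (walk-end w) refl)
  path-unique acyclic {x} (step {y = a} ea w₁ , x∉p ∷ u₁) (step {y = b} eb w₂ , x∉q ∷ u₂)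
    with a ≟ b
  ... | yes refl = cong (x ∷_) (path-unique acyclic (w₁ , u₁) (w₂ , u₂))
  ... | no a≢b with reverse w₂
  ...   | q′ , wq′ , q′⊆q , _ with join w₁ wq′
  ...     | j , wj , _ , mem with shortcut wj
  ...       | r , (wr , ur) , r⊆j , _ =
    ⊥-elim (acyclic (x , b , x ∷ r , (step ea wr , ¬Any⇒All¬ r x∉r ∷ ur) ,
                     s≤s (walk-length wr a≢b) , Graph.sym T eb))
    where
    x∉r : x ∉ r
    x∉r x∈r with mem (r⊆j x∈r)
    ... | inj₁ x∈p  = All.lookup x∉p x∈p refl
    ... | inj₂ x∈q′ = All.lookup x∉q (q′⊆q x∈q′) refl

  weight-≤-length : ∀ f l → (∀ {u v} → u ∈ l → v ∈ l → f u v ≤ 1) → weight T f l ≤ length l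
  weight-≤-length f []            _     = z≤n
  weight-≤-length f (_ ∷ [])      _     = z≤n
  weight-≤-length f (a ∷ b ∷ r) cheap =
    +-mono-≤ (cheap (here refl) (there (here refl)))
             (weight-≤-length f (b ∷ r) λ u∈ v∈ → cheap (there u∈) (there v∈))

  exit-cost : ∀ f (S : List (Fin n)) (M : ℕ) → (∀ {u v} → u ∈ S → v ∉ S → M ≤ f u v) →
    ∀ {a b l} → Walk T a b l → a ∈ S → b ∉ S → M ≤ weight T f l
  exit-cost f S M exit here a∈S b∉S = ⊥-elim (b∉S a∈S)
  exit-cost f S M exit (step {x} {y} e w) x∈S b∉S with y ∈? S
  ... | yes y∈S = ≤-trans (exit-cost f S M exit w y∈S b∉S)
                    (≤-trans (m≤n+m _ (f x y)) (≤-reflexive (sym (weight-cons f w))))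
  ... | no  y∉S = ≤-trans (exit x∈S y∉S)
                    (≤-trans (m≤m+n (f x y) _) (≤-reflexive (sym (weight-cons f w))))

  satisfies⇒disjoint : ∀ f → SymmetricOnEdges f → ∀ {x₀ y₀ x₁ y₁} →
    Satisfies T f x₀ y₀ x₁ y₁ →
    ∀ p q → IsPath T x₀ y₀ p → IsPath T x₁ y₁ q → ∀ v → v ∈ p → v ∉ q
  satisfies⇒disjoint f fsym (k , le₀ , le₁ , gt₀ , gt₁) p q pp pq v v∈p v∈q
    with split (proj₁ pp) v∈p | split (proj₁ pq) v∈q
  ... | A , B , wA , wB , sumP | C , D , wC , wD , sumQ
    with path-back f fsym wC wB | path-back f fsym wA wD
  ... | r₀ , pr₀ , r₀≤ | r₁ , pr₁ , r₁≤ =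
    four-point-contradiction (w A) (w B) (w C) (w D) k
      (subst (_≤ k) (sym (sumP f)) (le₀ p pp))
      (subst (_≤ k) (sym (sumQ f)) (le₁ q pq))
      (≤-trans (gt₀ r₀ pr₀) r₀≤)
      (≤-trans (gt₁ r₁ pr₁) r₁≤)
    where
    w : List (Fin n) → ℕ
    w = weight T f

  module Separating (P Q : List (Fin n)) (disjoint : ∀ v → v ∈ P → v ∉ Q) where
    K : ℕ
    K = length P + length Q

    Near : Fin n → Fin n → Set
    Near u v = (u ∈ P × v ∈ P) ⊎ (u ∈ Q × v ∈ Q)

    near-sym : ∀ {u v} → Near u v → Near v u
    near-sym (inj₁ (u∈ , v∈)) = inj₁ (v∈ , u∈)
    near-sym (inj₂ (u∈ , v∈)) = inj₂ (v∈ , u∈)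

    cost : Weighting
    cost u v with (u ∈? P ×-dec v ∈? P) ⊎-dec (u ∈? Q ×-dec v ∈? Q)
    ... | yes _ = 1
    ... | no  _ = suc K

    cost-near : ∀ {u v} → Near u v → cost u v ≡ 1
    cost-near {u} {v} near with (u ∈? P ×-dec v ∈? P) ⊎-dec (u ∈? Q ×-dec v ∈? Q)
    ... | yes _ = refl
    ... | no ¬near = ⊥-elim (¬near near)

    cost-far : ∀ {u v} → ¬ Near u v → cost u v ≡ suc K
    cost-far {u} {v} far with (u ∈? P ×-dec v ∈? P) ⊎-dec (u ∈? Q ×-dec v ∈? Q)
    ... | yes near = ⊥-elim (far near)
    ... | no _ = refl

    cost-sym : ∀ u v → cost u v ≡ cost v u
    cost-sym u v with (u ∈? P ×-dec v ∈? P) ⊎-dec (u ∈? Q ×-dec v ∈? Q)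
    ... | yes near = sym (cost-near (near-sym near))
    ... | no  far  = sym (cost-far (λ near → far (near-sym near)))

    cost-positive : ∀ u v → 0 < cost u v
    cost-positive u v with (u ∈? P ×-dec v ∈? P) ⊎-dec (u ∈? Q ×-dec v ∈? Q)
    ... | yes _ = s≤s z≤n
    ... | no  _ = s≤s z≤n

    exit-P : ∀ {u v} → u ∈ P → v ∉ P → suc K ≤ cost u v
    exit-P u∈P v∉P = ≤-reflexive (sym (cost-far
      λ { (inj₁ (_ , v∈P)) → v∉P v∈P ; (inj₂ (u∈Q , _)) → disjoint _ u∈P u∈Q }))

    exit-Q : ∀ {u v} → u ∈ Q → v ∉ Q → suc K ≤ cost u v
    exit-Q u∈Q v∉Q = ≤-reflexive (sym (cost-far
      λ { (inj₁ (u∈P , _)) → disjoint _ u∈P u∈Q ; (inj₂ (_ , v∈Q)) → v∉Q v∈Q }))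

  disjoint⇒can-satisfy : ¬ HasCycle T → ∀ {x₀ y₀ x₁ y₁ P Q} →
    IsPath T x₀ y₀ P → IsPath T x₁ y₁ Q → (∀ v → v ∈ P → v ∉ Q) →
    CanSatisfy T x₀ y₀ x₁ y₁
  disjoint⇒can-satisfy acyclic {x₀} {y₀} {x₁} {y₁} {P} {Q} pP pQ disjoint =
    cost , ((λ u v _ → cost-sym u v) , (λ u v _ → cost-positive u v)) , K ,
    (λ p pp → subst (λ l → weight T cost l ≤ K) (path-unique acyclic pP pp)
                (≤-trans (weight-≤-length cost P (λ u∈ v∈ → cheap (inj₁ (u∈ , v∈))))
                         (m≤m+n _ _))) ,
    (λ p pp → subst (λ l → weight T cost l ≤ K) (path-unique acyclic pQ pp)
                (≤-trans (weight-≤-length cost Q (λ u∈ v∈ → cheap (inj₂ (u∈ , v∈))))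
                         (m≤n+m _ _))) ,
    (λ p pp → exit-cost cost P (suc K) exit-P (proj₁ pp) (walk-end (proj₁ pP))
                (λ x₁∈P → disjoint x₁ x₁∈P (walk-start (proj₁ pQ)))) ,
    (λ p pp → exit-cost cost Q (suc K) exit-Q (proj₁ pp) (walk-end (proj₁ pQ))
                (λ x₀∈Q → disjoint x₀ (walk-start (proj₁ pP)) x₀∈Q))
    where
    open Separating P Q disjoint
    cheap : ∀ {u v} → Near u v → cost u v ≤ 1
    cheap near = ≤-reflexive (cost-near near)

corollary1 : ∀ {m n} (G : Graph m) (T : Graph n) (e : Fin m → Fin n) →
    Injective _≡_ _≡_ e → IsTree T →
    ∀ x0 y0 x1 y1 → AlternatingCycle G x0 y0 x1 y1 →
    IsLeaf T (e x0) → IsLeaf T (e y0) → IsLeaf T (e x1) → IsLeaf T (e y1) →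
    CanSatisfy T (e x0) (e y0) (e x1) (e y1) ⇔ ContainsQuartet T (e x0) (e y0) (e x1) (e y1)
corollary1 G T e _ (connected , acyclic) x0 y0 x1 y1 _ l₀ l₁ l₂ l₃ =
  mk⇔ satisfiable⇒quartet quartet⇒satisfiable
  where
  open WalkSurgery T
  satisfiable⇒quartet : CanSatisfy T (e x0) (e y0) (e x1) (e y1) →
                        ContainsQuartet T (e x0) (e y0) (e x1) (e y1)
  satisfiable⇒quartet (f , (fsym , _) , sat) =
    l₀ , l₁ , l₂ , l₃ , satisfies⇒disjoint f fsym sat
  quartet⇒satisfiable : ContainsQuartet T (e x0) (e y0) (e x1) (e y1) →
                        CanSatisfy T (e x0) (e y0) (e x1) (e y1)
  quartet⇒satisfiable (_ , _ , _ , _ , apart)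
    with connected (e x0) (e y0) | connected (e x1) (e y1)
  ... | P , pP | Q , pQ = disjoint⇒can-satisfy acyclic pP pQ (apart P Q pP pQ)
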